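{- Let $g\ge4$ be even and let $q>g-1$ be an integer relatively prime to $g-1$. Let $m=\frac{g^q-1}{g-1}$. Then $m$ is incomplete and $o_g(m)=q$; moreover every divisor $e>1$ of $m$ satisfies $o_g(e)\neq1$ and $o_g(e)\mid q$. If, in addition, $q$ is prime, then there exist primitive numbers of order $q$, and every primitive number $d$ dividing $m$ satisfies $o_g(d)=q$.
   Context: For an odd integer $m\ge1$, an extreme cycle for the digit set $\{0,m\}$ (with respect to the even integer $g\ge4$) is a finite set of distinct integers $\{x_0,\dots,x_{r-1}\}$ together with digits $l_0,\dots,l_{r-1}\in\{0,m\}$ such that $x_{j+1}=(x_j+l_j)/g$ for $0\le j\le r-2$ and $x_0=(x_{r-1}+l_{r-1})/g$. The cycle $\{0\}$ is the trivial extreme cycle. $m$ is complete if the only extreme cycle for $\{0,m\}$ is the trivial one, and incomplete otherwise. An odd number $m$ is primitive if it is incomplete and every proper divisor of $m$ is complete. For $m$ coprime to $g$, $o_g(m)$ (the order of $m$) denotes the order of $g$ in $U(\mathbb{Z}_m)$. -}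

module Defs where

open import Data.Nat as ℕ using (ℕ; zero; suc; _∸_; _^_; _≤_)
open import Data.Nat.Divisibility using (_∣_)
open import Data.Integer as ℤ using (ℤ; +_)
open import Data.Fin using (Fin; fromℕ; inject₁) renaming (zero to fzero; suc to fsuc)
open import Data.Product using (Σ; ∃; _×_)
open import Data.Sum using (_⊎_)
open import Function.Definitions using (Injective)
open import Relation.Binary.PropositionalEquality using (_≡_; _≢_)
open import Relation.Nullary using (¬_)

-- An extreme cycle for the digit set {0,m} w.r.t. base g, of length r = suc n:
-- distinct integers x_0..x_n with digits l_j ∈ {0,m} such that
-- g·x_{j+1} = x_j + l_j (j < n) and g·x_0 = x_n + l_n
-- (i.e. x_{j+1} = (x_j + l_j)/g with exact division).
record ExtremeCycle (g m : ℕ) : Set where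
  field
    n        : ℕ
    x        : Fin (suc n) → ℤ
    l        : Fin (suc n) → ℤ
    distinct : Injective _≡_ _≡_ x
    digit    : ∀ j → l j ≡ + 0 ⊎ l j ≡ + m
    step     : ∀ (j : Fin n) →
               (+ g) ℤ.* x (fsuc j) ≡ x (inject₁ j) ℤ.+ l (inject₁ j)
    close    : (+ g) ℤ.* x fzero ≡ x (fromℕ n) ℤ.+ l (fromℕ n)

Trivial : ∀ {g m} → ExtremeCycle g m → Set
Trivial c = ExtremeCycle.n c ≡ 0 × ExtremeCycle.x c fzero ≡ + 0

Incomplete : ℕ → ℕ → Set
Incomplete g m = Σ (ExtremeCycle g m) λ c → ¬ Trivial c

Complete : ℕ → ℕ → Set
Complete g m = ¬ Incomplete g m

Primitive : ℕ → ℕ → Set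
Primitive g m = ¬ (2 ∣ m) × Incomplete g m × (∀ d → d ∣ m → d ≢ m → Complete g d)

Order : ℕ → ℕ → ℕ → Set
Order g m k = 1 ≤ k × m ∣ (g ^ k ∸ 1) × (∀ j → 1 ≤ j → m ∣ (g ^ j ∸ 1) → k ≤ j)

-- The repunit m = 1 + g + ⋯ + g^(q-1) = (g^q − 1)/(g − 1) carries an explicit nontrivial
-- extreme cycle: with a = g − 1 < q, take the digits l_t = m for t < a and l_t = 0 for
-- a ≤ t < q, repeated with period q; its t-th point is
-- (repunit (a − t) + g^(q−t)·repunit (min t a))/a, starting at (g^a − 1)/a² ≠ 0.
-- The order of g modulo m is q since a·repunit j < m for j < q. The order k of g modulo
-- a divisor e > 1 divides q, and k = 1 would give e ∣ a, while m ≡ q (mod a) and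
-- gcd (q, a) = 1. Primitive divisors are found by descent through
-- the divisors of m, which needs incompleteness to be decidable: every point of an extreme
-- cycle for an odd digit d lies in [0, d/a], so a nontrivial cycle is a periodic orbit of
-- the digit-choosing map with start ≤ d and period ≤ d + 1.
module Submission where

open import Data.Bool using (if_then_else_)
open import Data.Empty using (⊥-elim)
open import Data.Fin as Fin using (Fin; toℕ; fromℕ; fromℕ<; inject₁) renaming (zero to fzero; suc to fsuc)
import Data.Fin.Properties as FinP
open import Data.Integer as ℤ using (ℤ; +_; -[1+_])
import Data.Integer.Properties as ℤP
open import Data.Nat
open import Data.Nat.Coprimality using (Coprime)
open import Data.Nat.Divisibility
open import Data.Nat.DivMod
open import Data.Nat.GeneralisedArithmetic using (fold; fold-+)
open import Data.Nat.Induction using (<-rec)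
open import Data.Nat.Primality using (Prime; prime⇒irreducible; prime⇒nonZero)
open import Data.Nat.Properties
open import Data.Nat.Tactic.RingSolver
open import Data.Product
open import Data.Sum using (_⊎_; inj₁; inj₂)
import Data.Sum as Sum
open import Function using (_∘_)
open import Function.Definitions using (Injective)
open import Relation.Binary.Bundles using (TotalPreorder)
import Relation.Binary.Construct.Flip.EqAndOrd as Flip
open import Relation.Binary.Definitions using (tri<; tri≈; tri>)
open import Relation.Binary.PropositionalEquality
open import Relation.Nullary
open import Relation.Unary using (Decidable)

open import Defs

repunit : ℕ → ℕ → ℕ
repunit g zero    = 0
repunit g (suc k) = 1 + g * repunit g k

repunit-+ : ∀ g s t → repunit g (s + t) ≡ repunit g s + g ^ s * repunit g t
repunit-+ g zero    t = sym (+-identityʳ _)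
repunit-+ g (suc s) t rewrite repunit-+ g s t = lemma g (repunit g s) (g ^ s) (repunit g t)
  where
  lemma : ∀ g x y z → 1 + g * (x + y * z) ≡ 1 + g * x + g * y * z
  lemma = solve-∀

repunit-suc : ∀ g k → repunit g (suc k) ≡ repunit g k + g ^ k
repunit-suc g k = begin
  repunit g (suc k)               ≡⟨ cong (repunit g) (+-comm 1 k) ⟩
  repunit g (k + 1)               ≡⟨ repunit-+ g k 1 ⟩
  repunit g k + g ^ k * (1 + g * 0) ≡⟨ cong (λ z → repunit g k + g ^ k * suc z) (*-zeroʳ g) ⟩
  repunit g k + g ^ k * 1         ≡⟨ cong (λ z → repunit g k + z) (*-identityʳ (g ^ k)) ⟩
  repunit g k + g ^ k             ∎
  where open ≡-Reasoning

^≡1+a*repunit : ∀ a k → suc a ^ k ≡ 1 + a * repunit (suc a) k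
^≡1+a*repunit a zero    = cong suc (sym (*-zeroʳ a))
^≡1+a*repunit a (suc k) rewrite ^≡1+a*repunit a k = lemma a (repunit (suc a) k)
  where
  lemma : ∀ a s → suc a * (1 + a * s) ≡ 1 + a * (1 + suc a * s)
  lemma = solve-∀

^∸1≡a*repunit : ∀ a k → suc a ^ k ∸ 1 ≡ a * repunit (suc a) k
^∸1≡a*repunit a k = cong (_∸ 1) (^≡1+a*repunit a k)

repunit≡k+t*a : ∀ a k → ∃[ t ] repunit (suc a) k ≡ k + t * a
repunit≡k+t*a a zero    = 0 , refl
repunit≡k+t*a a (suc k) with repunit≡k+t*a a k
... | t , eq rewrite eq = k + t + t * a , lemma a k t
  where
  lemma : ∀ a k t → 1 + suc a * (k + t * a) ≡ suc k + (k + t + t * a) * a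
  lemma = solve-∀

repunit-odd : ∀ {g} → 2 ∣ g → ∀ {k} → 1 ≤ k → ¬ 2 ∣ repunit g k
repunit-odd {g} 2∣g {suc k} _ 2∣R with ∣1⇒≡1 (∣m+n∣m⇒∣n 2∣R+1 (∣m⇒∣m*n (repunit g k) 2∣g))
  where
  2∣R+1 : 2 ∣ g * repunit g k + 1
  2∣R+1 = subst (2 ∣_) (+-comm 1 (g * repunit g k)) 2∣R
... | ()

repunit-pos : ∀ {g k} → 1 ≤ k → 1 ≤ repunit g k
repunit-pos {k = suc _} _ = s≤s z≤n

repunit-mono-≤ : ∀ g {j k} → j ≤ k → repunit g j ≤ repunit g k
repunit-mono-≤ g {j} {k} j≤k = begin
  repunit g j                              ≤⟨ m≤m+n _ _ ⟩
  repunit g j + g ^ j * repunit g (k ∸ j)  ≡⟨ repunit-+ g j (k ∸ j) ⟨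
  repunit g (j + (k ∸ j))                  ≡⟨ cong (repunit g) (m+[n∸m]≡n j≤k) ⟩
  repunit g k                              ∎
  where open ≤-Reasoning

^∸1-+ : ∀ a r s → suc a ^ (r + s) ∸ 1 ≡ suc a ^ r * (suc a ^ s ∸ 1) + (suc a ^ r ∸ 1)
^∸1-+ a r s = begin
  suc a ^ (r + s) ∸ 1                               ≡⟨ ^∸1≡a*repunit a (r + s) ⟩
  a * repunit g (r + s)                             ≡⟨ cong (a *_) (repunit-+ g r s) ⟩
  a * (repunit g r + g ^ r * repunit g s)           ≡⟨ lemma a (repunit g r) (g ^ r) (repunit g s) ⟩
  g ^ r * (a * repunit g s) + a * repunit g r       ≡⟨ cong₂ (λ u v → g ^ r * u + v) (^∸1≡a*repunit a s) (^∸1≡a*repunit a r) ⟨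
  g ^ r * (g ^ s ∸ 1) + (g ^ r ∸ 1)                 ∎
  where
  open ≡-Reasoning
  g = suc a
  lemma : ∀ a x y z → a * (x + y * z) ≡ y * (a * z) + a * x
  lemma = solve-∀

∣^∸1⇒∣^*∸1 : ∀ {a e} k → e ∣ suc a ^ k ∸ 1 → ∀ c → e ∣ suc a ^ (c * k) ∸ 1
∣^∸1⇒∣^*∸1 {a} {e} k e∣ zero    = e ∣0
∣^∸1⇒∣^*∸1 {a} {e} k e∣ (suc c) rewrite ^∸1-+ a k (c * k) =
  ∣m∣n⇒∣m+n (∣n⇒∣m*n (suc a ^ k) (∣^∸1⇒∣^*∸1 k e∣ c)) e∣

minimal-witness : ∀ {p} {P : ℕ → Set p} → Decidable P → ∀ n → P n →
                  ∃[ k ] P k × (∀ j → P j → k ≤ j)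
minimal-witness {P = P} P? n pn = search n 0 (λ _ ()) (subst P (sym (+-identityˡ n)) pn)
  where
  search : ∀ n i → (∀ j → j < i → ¬ P j) → P (i + n) → ∃[ k ] P k × (∀ j → P j → k ≤ j)
  search n i below pin with P? i
  ... | yes pi = i , pi , λ j pj → ≮⇒≥ (λ j<i → below j j<i pj)
  search zero    i below pin | no ¬pi = ⊥-elim (¬pi (subst P (+-identityʳ i) pin))
  search (suc n) i below pin | no ¬pi = search n (suc i) below′ (subst P (+-suc i n) pin)
    where
    below′ : ∀ j → j < suc i → ¬ P j
    below′ j j<1+i with m≤n⇒m<n∨m≡n (≤-pred j<1+i)
    ... | inj₁ j<i  = below j j<i
    ... | inj₂ refl = ¬pi

order-exists : ∀ {a e q} → 1 ≤ q → e ∣ suc a ^ q ∸ 1 → ∃[ k ] Order (suc a) e k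
order-exists {a} {e} {q} 1≤q e∣ with minimal-witness P? q (1≤q , e∣)
  where
  P : ℕ → Set
  P j = 1 ≤ j × e ∣ suc a ^ j ∸ 1
  P? : Decidable P
  P? j = (1 ≤? j) ×-dec (e ∣? suc a ^ j ∸ 1)
... | k , (1≤k , e∣k) , least = k , 1≤k , e∣k , λ j 1≤j e∣j → least j (1≤j , e∣j)

order∣ : ∀ {a e k q} → Order (suc a) e k → e ∣ suc a ^ q ∸ 1 → k ∣ q
order∣ {a} {e} {k@(suc _)} {q} (_ , e∣k , least) e∣q with q % k in q%k≡r
... | zero   = m%n≡0⇒n∣m q k q%k≡r
... | suc r′ = ⊥-elim (<⇒≱ r<k (least r (s≤s z≤n) e∣r))
  where
  r = suc r′
  r<k : r < k
  r<k = subst (_< k) q%k≡r (m%n<n q k)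
  q≡r+ck : q ≡ r + q / k * k
  q≡r+ck = trans (m≡m%n+[m/n]*n q k) (cong (_+ q / k * k) q%k≡r)
  e∣r : e ∣ suc a ^ r ∸ 1
  e∣r = ∣m+n∣m⇒∣n (subst (e ∣_) (trans (cong (λ z → suc a ^ z ∸ 1) q≡r+ck) (^∸1-+ a r (q / k * k))) e∣q)
                  (∣n⇒∣m*n (suc a ^ r) (∣^∸1⇒∣^*∸1 k e∣k (q / k)))

fold-injective-below-period :
  ∀ {A : Set} (f : A → A) (x : A) {p} → (∀ j → 1 ≤ j → fold x f j ≡ x → p ≤ j) →
  fold x f p ≡ x → ∀ {i j} → i < j → j < p → fold x f i ≢ fold x f j
fold-injective-below-period f x {p} least period {i} {j} i<j j<p fᵢ≡fⱼ =
  <⇒≱ t+i<p (least (t + i) (≤-trans (m<n⇒0<n∸m j<p) (m≤m+n t i)) returns)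
  where
  t = p ∸ j
  t+j≡p : t + j ≡ p
  t+j≡p = m∸n+n≡m (<⇒≤ j<p)
  t+i<p : t + i < p
  t+i<p = subst (t + i <_) t+j≡p (+-monoʳ-< t i<j)
  returns : fold x f (t + i) ≡ x
  returns = begin
    fold x f (t + i)            ≡⟨ fold-+ x f t ⟩
    fold (fold x f i) f t       ≡⟨ cong (λ z → fold z f t) fᵢ≡fⱼ ⟩
    fold (fold x f j) f t       ≡⟨ fold-+ x f t ⟨
    fold x f (t + j)            ≡⟨ cong (fold x f) t+j≡p ⟩
    fold x f p                  ≡⟨ period ⟩
    x                           ∎
    where open ≡-Reasoning

module Dynamics (g d : ℕ) .{{_ : NonZero g}} where

  -- For g even and d odd at most one digit l ∈ {0, d} makes g ∣ y + l;
  -- when none does, y is not Admissible and next y is a junk value.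
  digitFor : ℕ → ℕ
  digitFor y = if does (g ∣? y) then 0 else d

  next : ℕ → ℕ
  next y = (y + digitFor y) / g

  orbit : ℕ → ℕ → ℕ
  orbit y t = fold y next t

  Admissible : ℕ → Set
  Admissible y = g ∣ y + digitFor y

  digitFor-digit : ∀ y → digitFor y ≡ 0 ⊎ digitFor y ≡ d
  digitFor-digit y with g ∣? y
  ... | yes _ = inj₁ refl
  ... | no  _ = inj₂ refl

  next-admissible : ∀ {y} → Admissible y → g * next y ≡ y + digitFor y
  next-admissible {y} g∣ = trans (*-comm g (next y)) (m/n*n≡m g∣)

  digitFor-forced : 2 ∣ g → ¬ 2 ∣ d → ∀ {y l} → g ∣ y + l → l ≡ 0 ⊎ l ≡ d → l ≡ digitFor y
  digitFor-forced 2∣g 2∤d {y} g∣y+l l-digit with g ∣? y | l-digit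
  ... | yes _   | inj₁ l≡0 = l≡0
  ... | yes g∣y | inj₂ refl = ⊥-elim (2∤d (∣-trans 2∣g (∣m+n∣m⇒∣n g∣y+l g∣y)))
  ... | no g∤y  | inj₁ refl = ⊥-elim (g∤y (subst (g ∣_) (+-identityʳ y) g∣y+l))
  ... | no _    | inj₂ l≡d = l≡d

  move⇒next : 2 ∣ g → ¬ 2 ∣ d → ∀ {y y′ l} → g * y′ ≡ y + l → l ≡ 0 ⊎ l ≡ d →
              Admissible y × next y ≡ y′
  move⇒next 2∣g 2∤d {y} {y′} {l} gy′≡y+l l-digit =
    subst (λ z → g ∣ y + z) l≡digit g∣y+l , (begin
      (y + digitFor y) / g   ≡⟨ cong (λ z → (y + z) / g) l≡digit ⟨
      (y + l) / g            ≡⟨ cong (_/ g) y′g≡y+l ⟨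
      y′ * g / g             ≡⟨ m*n/n≡m y′ g ⟩
      y′                     ∎)
    where
    open ≡-Reasoning
    y′g≡y+l : y′ * g ≡ y + l
    y′g≡y+l = trans (*-comm y′ g) gy′≡y+l
    g∣y+l : g ∣ y + l
    g∣y+l = divides y′ (sym y′g≡y+l)
    l≡digit : l ≡ digitFor y
    l≡digit = digitFor-forced 2∣g 2∤d g∣y+l l-digit

  module _ (y₀ n : ℕ) (period : orbit y₀ (suc n) ≡ y₀)
           (least : ∀ j → 1 ≤ j → orbit y₀ j ≡ y₀ → suc n ≤ j)
           (admissible : ∀ i → i ≤ n → Admissible (orbit y₀ i)) where

    private
      Move : ℕ → ℕ → Set
      Move u t = + g ℤ.* + u ≡ + orbit y₀ t ℤ.+ + digitFor (orbit y₀ t)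

      moves : ∀ t → t ≤ n → Move (orbit y₀ (suc t)) t
      moves t t≤n = trans (sym (ℤP.pos-* g _)) (cong +_ (next-admissible (admissible t t≤n)))

      orbit-injective : ∀ {i j} → i < j → j ≤ n → orbit y₀ i ≢ orbit y₀ j
      orbit-injective i<j j≤n = fold-injective-below-period next y₀ least period i<j (s≤s j≤n)

    orbit-cycle : ExtremeCycle g d
    orbit-cycle = record
      { n        = n
      ; x        = λ j → + orbit y₀ (toℕ j)
      ; l        = λ j → + digitFor (orbit y₀ (toℕ j))
      ; distinct = distinct
      ; digit    = λ j → Sum.map (cong (λ m → + m)) (cong (λ m → + m)) (digitFor-digit _)
      ; step     = λ j → subst (Move _) (sym (FinP.toℕ-inject₁ j)) (moves (toℕ j) (<⇒≤ (FinP.toℕ<n j)))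
      ; close    = subst₂ Move period (sym (FinP.toℕ-fromℕ n)) (moves n ≤-refl)
      }
      where
      distinct : Injective _≡_ _≡_ (λ (j : Fin (suc n)) → + orbit y₀ (toℕ j))
      distinct {i} {j} xᵢ≡xⱼ with <-cmp (toℕ i) (toℕ j)
      ... | tri< i<j _ _ = ⊥-elim (orbit-injective i<j (FinP.toℕ≤pred[n] j) (ℤP.+-injective xᵢ≡xⱼ))
      ... | tri≈ _ i≡j _ = FinP.toℕ-injective i≡j
      ... | tri> _ _ j<i = ⊥-elim (orbit-injective j<i (FinP.toℕ≤pred[n] i) (sym (ℤP.+-injective xᵢ≡xⱼ)))

  ReturnsAfter : ℕ → ℕ → Set
  ReturnsAfter y₀ k = 1 ≤ k × orbit y₀ k ≡ y₀ × (∀ {i} → i < k → Admissible (orbit y₀ i))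

  returnsAfter? : ∀ y₀ k → Dec (ReturnsAfter y₀ k)
  returnsAfter? y₀ k = (1 ≤? k) ×-dec (orbit y₀ k ≟ y₀) ×-dec allUpTo? (λ i → g ∣? orbit y₀ i + digitFor (orbit y₀ i)) k

  periodic-orbit→incomplete : ∀ {y₀ k} → y₀ ≢ 0 → ReturnsAfter y₀ k → Incomplete g d
  periodic-orbit→incomplete {y₀} {k} y₀≢0 (1≤k , returns , admissible)
    with minimal-witness (λ j → (1 ≤? j) ×-dec (orbit y₀ j ≟ y₀)) k (1≤k , returns)
  ... | suc n , (_ , period) , least =
    orbit-cycle y₀ n period (λ j 1≤j back → least j (1≤j , back))
                (λ i i≤n → admissible (<-≤-trans (s≤s i≤n) (least k (1≤k , returns)))) ,
    λ (_ , x₀≡0) → y₀≢0 (ℤP.+-injective x₀≡0)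

  module _ (2∣g : 2 ∣ g) (2∤d : ¬ 2 ∣ d) (z l : ℕ → ℕ) (n : ℕ)
           (moves : ∀ t → t < n → g * z (suc t) ≡ z t + l t)
           (digits : ∀ t → t < n → l t ≡ 0 ⊎ l t ≡ d) where

    trajectory-orbit : ∀ t → t ≤ n → orbit (z 0) t ≡ z t
    trajectory-orbit zero    _   = refl
    trajectory-orbit (suc t) t<n = trans (cong next (trajectory-orbit t (<⇒≤ t<n)))
                                         (proj₂ (move⇒next 2∣g 2∤d (moves t t<n) (digits t t<n)))

    trajectory-returns : 1 ≤ n → z n ≡ z 0 → ReturnsAfter (z 0) n
    trajectory-returns 1≤n zₙ≡z₀ =
      1≤n , trans (trajectory-orbit n ≤-refl) zₙ≡z₀ ,
      λ {i} i<n → subst Admissible (sym (trajectory-orbit i (<⇒≤ i<n)))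
                        (proj₁ (move⇒next 2∣g 2∤d (moves i i<n) (digits i i<n)))

module _ {c ℓ₁ ℓ₂} (O : TotalPreorder c ℓ₁ ℓ₂) where
  open TotalPreorder O using (Carrier; _≲_; total) renaming (refl to ≲-refl; trans to ≲-trans)

  argmax : ∀ {n} (f : Fin (suc n) → Carrier) → ∃[ i ] ∀ j → f j ≲ f i
  argmax {zero}  f = fzero , λ { fzero → ≲-refl }
  argmax {suc n} f with argmax (λ j → f (fsuc j))
  ... | i , max with total (f fzero) (f (fsuc i))
  ...   | inj₁ f₀≲ = fsuc i , λ { fzero → f₀≲ ; (fsuc j) → max j }
  ...   | inj₂ ≲f₀ = fzero  , λ { fzero → ≲-refl ; (fsuc j) → ≲-trans (max j) ≲f₀ }

i≤[1+a]*i⇒0≤i : ∀ {a} → 1 ≤ a → ∀ i → i ℤ.≤ + suc a ℤ.* i → + 0 ℤ.≤ i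
i≤[1+a]*i⇒0≤i _       (+ _)    _            = ℤ.+≤+ z≤n
i≤[1+a]*i⇒0≤i {suc _} _ -[1+ k ] (ℤ.-≤- k+n≤k) = ⊥-elim (<⇒≱ (m<m+n k (s≤s z≤n)) k+n≤k)

-- Since g·x_j = x_i + l_i for some i, the least point satisfies x_min ≤ g·x_min, so it is
-- nonnegative, and the greatest satisfies g·y_max ≤ y_max + d.
module CycleBounds {a d : ℕ} (1≤a : 1 ≤ a) (c : ExtremeCycle (suc a) d) where
  open ExtremeCycle c

  private
    g = suc a

  predecessor : ∀ j → ∃[ i ] + g ℤ.* x j ≡ x i ℤ.+ l i
  predecessor fzero    = fromℕ n , close
  predecessor (fsuc j) = inject₁ j , step j

  digit-nonneg : ∀ j → + 0 ℤ.≤ l j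
  digit-nonneg j with digit j
  ... | inj₁ lⱼ≡0 = ℤP.≤-reflexive (sym lⱼ≡0)
  ... | inj₂ lⱼ≡d = subst (+ 0 ℤ.≤_) (sym lⱼ≡d) (ℤ.+≤+ z≤n)

  x-nonneg : ∀ j → + 0 ℤ.≤ x j
  x-nonneg j = ℤP.≤-trans (i≤[1+a]*i⇒0≤i 1≤a (x jₘ) xₘ≤gxₘ) (min j)
    where
    jₘ = proj₁ (argmax (Flip.totalPreorder ℤP.≤-totalPreorder) x)
    min = proj₂ (argmax (Flip.totalPreorder ℤP.≤-totalPreorder) x)
    i = proj₁ (predecessor jₘ)
    xₘ≤gxₘ : x jₘ ℤ.≤ + g ℤ.* x jₘ
    xₘ≤gxₘ = begin
      x jₘ           ≡⟨ ℤP.+-identityʳ (x jₘ) ⟨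
      x jₘ ℤ.+ + 0   ≤⟨ ℤP.+-mono-≤ (min i) (digit-nonneg i) ⟩
      x i ℤ.+ l i    ≡⟨ proj₂ (predecessor jₘ) ⟨
      + g ℤ.* x jₘ   ∎
      where open ℤP.≤-Reasoning

  y : Fin (suc n) → ℕ
  y j = ℤ.∣ x j ∣

  δ : Fin (suc n) → ℕ
  δ j = ℤ.∣ l j ∣

  x≡+y : ∀ j → x j ≡ + y j
  x≡+y j = sym (ℤP.0≤i⇒+∣i∣≡i (x-nonneg j))

  l≡+δ : ∀ j → l j ≡ + δ j
  l≡+δ j = sym (ℤP.0≤i⇒+∣i∣≡i (digit-nonneg j))

  δ-digit : ∀ j → δ j ≡ 0 ⊎ δ j ≡ d
  δ-digit j = Sum.map (cong ℤ.∣_∣) (cong ℤ.∣_∣) (digit j)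

  move-ℕ : ∀ {i j} → + g ℤ.* x j ≡ x i ℤ.+ l i → g * y j ≡ y i + δ i
  move-ℕ {i} {j} gxⱼ≡xᵢ+lᵢ = ℤP.+-injective (begin
    + (g * y j)         ≡⟨ ℤP.pos-* g (y j) ⟩
    + g ℤ.* + y j       ≡⟨ cong (+ g ℤ.*_) (x≡+y j) ⟨
    + g ℤ.* x j         ≡⟨ gxⱼ≡xᵢ+lᵢ ⟩
    x i ℤ.+ l i         ≡⟨ cong₂ ℤ._+_ (x≡+y i) (l≡+δ i) ⟩
    + (y i + δ i)       ∎)
    where open ≡-Reasoning

  a*y≤d : ∀ j → a * y j ≤ d
  a*y≤d j = ≤-trans (*-monoʳ-≤ a (max j)) (+-cancelˡ-≤ (y jₘ) (a * y jₘ) d (begin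
    g * y jₘ     ≡⟨ move-ℕ (proj₂ (predecessor jₘ)) ⟩
    y i + δ i    ≤⟨ +-mono-≤ (max i) (δ≤d i) ⟩
    y jₘ + d     ∎))
    where
    open ≤-Reasoning
    jₘ = proj₁ (argmax ≤-totalPreorder y)
    max = proj₂ (argmax ≤-totalPreorder y)
    i = proj₁ (predecessor jₘ)
    δ≤d : ∀ i → δ i ≤ d
    δ≤d i with δ-digit i
    ... | inj₁ δᵢ≡0 = subst (_≤ d) (sym δᵢ≡0) z≤n
    ... | inj₂ δᵢ≡d = ≤-reflexive δᵢ≡d

  y≤d : ∀ j → y j ≤ d
  y≤d j = ≤-trans (m≤n*m (y j) a {{>-nonZero 1≤a}}) (a*y≤d j)

  y-injective : ∀ {i j} → y i ≡ y j → i ≡ j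
  y-injective {i} {j} yᵢ≡yⱼ = distinct (trans (x≡+y i) (trans (cong (λ m → + m) yᵢ≡yⱼ) (sym (x≡+y j))))

  n≤d : n ≤ d
  n≤d with n ≤? d
  ... | yes n≤d = n≤d
  ... | no  n≰d with FinP.pigeonhole (s≤s (≰⇒> n≰d)) (λ j → fromℕ< (s≤s (y≤d j)))
  ...   | i , j , i<j , same = ⊥-elim (<-irrefl (cong toℕ (y-injective yᵢ≡yⱼ)) i<j)
    where
    yᵢ≡yⱼ : y i ≡ y j
    yᵢ≡yⱼ = trans (sym (FinP.toℕ-fromℕ< _)) (trans (cong toℕ same) (FinP.toℕ-fromℕ< _))

  nontrivial⇒y₀≢0 : ¬ Trivial c → y fzero ≢ 0
  nontrivial⇒y₀≢0 nontrivial y₀≡0 = nontrivial (n≡0 , trans (x≡+y fzero) (cong (λ m → + m) y₀≡0))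
    where
    yₙ≡0 : y (fromℕ n) ≡ 0
    yₙ≡0 = m+n≡0⇒m≡0 (y (fromℕ n)) (trans (sym (move-ℕ close)) (trans (cong (g *_) y₀≡0) (*-zeroʳ g)))
    n≡0 : n ≡ 0
    n≡0 = trans (sym (FinP.toℕ-fromℕ n)) (cong toℕ (y-injective (trans yₙ≡0 (sym y₀≡0))))

  private
    index : ℕ → Fin (suc n)
    index t with t ≤? n
    ... | yes t≤n = fromℕ< (s≤s t≤n)
    ... | no  _   = fzero

    toℕ≡⇒index≡ : ∀ {t} i → toℕ i ≡ t → index t ≡ i
    toℕ≡⇒index≡ {t} i refl with toℕ i ≤? n
    ... | yes _   = FinP.toℕ-injective (FinP.toℕ-fromℕ< _)
    ... | no  i≰n = ⊥-elim (i≰n (FinP.toℕ≤pred[n] i))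

    index-wraps : index (suc n) ≡ fzero
    index-wraps with suc n ≤? n
    ... | yes 1+n≤n = ⊥-elim (<-irrefl refl 1+n≤n)
    ... | no  _     = refl

    Move : ℕ → Set
    Move t = g * y (index (suc t)) ≡ y (index t) + δ (index t)

    move-between : ∀ {t i j} → index t ≡ i → index (suc t) ≡ j → + g ℤ.* x j ≡ x i ℤ.+ l i → Move t
    move-between refl refl gxⱼ≡xᵢ+lᵢ = move-ℕ gxⱼ≡xᵢ+lᵢ

    index-move : ∀ t → t < suc n → Move t
    index-move t t<1+n with m≤n⇒m<n∨m≡n (≤-pred t<1+n)
    ... | inj₁ t<n = move-between (toℕ≡⇒index≡ (inject₁ j) (trans (FinP.toℕ-inject₁ j) toℕj≡t))
                                  (toℕ≡⇒index≡ (fsuc j) (cong suc toℕj≡t)) (step j)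
      where
      j = fromℕ< t<n
      toℕj≡t : toℕ j ≡ t
      toℕj≡t = FinP.toℕ-fromℕ< t<n
    ... | inj₂ refl = move-between (toℕ≡⇒index≡ (fromℕ n) (FinP.toℕ-fromℕ n)) index-wraps close

  cycle-returns : 2 ∣ g → ¬ 2 ∣ d → Dynamics.ReturnsAfter g d (y fzero) (suc n)
  cycle-returns 2∣g 2∤d =
    Dynamics.trajectory-returns g d 2∣g 2∤d (λ t → y (index t)) (λ t → δ (index t)) (suc n)
      index-move (λ t _ → δ-digit (index t)) (s≤s z≤n) (cong y index-wraps)

incomplete? : ∀ {a d} → 1 ≤ a → 2 ∣ suc a → ¬ 2 ∣ d → Dec (Incomplete (suc a) d)
incomplete? {a} {d} 1≤a 2∣g 2∤d =
  map′ (λ (_ , _ , y₀≢0 , _ , _ , returns) → periodic-orbit→incomplete y₀≢0 returns)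
       (λ (c , nontrivial) → let open CycleBounds 1≤a c in
          y fzero , s≤s (y≤d fzero) , nontrivial⇒y₀≢0 nontrivial ,
          suc (ExtremeCycle.n c) , s≤s (s≤s n≤d) , cycle-returns 2∣g 2∤d)
       (anyUpTo? (λ y₀ → ¬? (y₀ ≟ 0) ×-dec anyUpTo? (returnsAfter? y₀) (2 + d)) (suc d))
  where open Dynamics (suc a) d

1-complete : ∀ {g} → 3 ≤ g → Complete g 1
1-complete {suc a} (s≤s 2≤a) (c , nontrivial) =
  <⇒≱ (s≤s (s≤s z≤n)) (≤-trans (≤-trans 2≤a a≤a*y₀) (a*y≤d fzero))
  where
  open CycleBounds (≤-trans (s≤s z≤n) 2≤a) c
  a≤a*y₀ : a ≤ a * y fzero
  a≤a*y₀ = m≤m*n a (y fzero) {{≢-nonZero (nontrivial⇒y₀≢0 nontrivial)}}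

primitive-divisor : ∀ {g m} → (∀ d → d ∣ m → Dec (Incomplete g d)) → m ≢ 0 → ¬ 2 ∣ m →
                    Incomplete g m → ∃[ d ] d ∣ m × Primitive g d
primitive-divisor {g} {m} incomplete? m≢0 2∤m = <-rec Goal descend m ∣-refl
  where
  Goal : ℕ → Set
  Goal d = d ∣ m → Incomplete g d → ∃[ d′ ] d′ ∣ m × Primitive g d′

  descend : ∀ d → (∀ {e} → e < d → Goal e) → Goal d
  descend d smaller d∣m incomplete with anyUpTo? incomplete-divisor? d
    where
    incomplete-divisor? : ∀ e → Dec (e ∣ d × Incomplete g e)
    incomplete-divisor? e with e ∣? d
    ... | yes e∣d = map′ (e∣d ,_) proj₂ (incomplete? e (∣-trans e∣d d∣m))
    ... | no  e∤d = no (e∤d ∘ proj₁)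
  ... | yes (e , e<d , e∣d , incompleteₑ) = smaller e<d (∣-trans e∣d d∣m) incompleteₑ
  ... | no  none = d , d∣m , (λ 2∣d → 2∤m (∣-trans 2∣d d∣m)) , incomplete , proper-complete
    where
    proper-complete : ∀ e → e ∣ d → e ≢ d → Complete g e
    proper-complete e e∣d e≢d incompleteₑ =
      none (e , ≤∧≢⇒< (∣⇒≤ {{≢-nonZero d≢0}} e∣d) e≢d , e∣d , incompleteₑ)
      where
      d≢0 : d ≢ 0
      d≢0 refl = m≢0 (0∣⇒≡0 d∣m)

repunit-shift : ∀ g k s t →
  1 + g * (repunit g k + g ^ s * repunit g (suc t)) ≡
  (repunit g (suc k) + g ^ suc s * repunit g t) + g ^ (suc s + t)
repunit-shift g k s t
  rewrite repunit-suc g t | ^-distribˡ-+-* g (suc s) t =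
  lemma g (repunit g k) (repunit g t) (g ^ s) (g ^ t)
  where
  lemma : ∀ g x y u v → 1 + g * (x + u * (y + v)) ≡ (1 + g * x + g * u * y) + g * u * v
  lemma = solve-∀

m+n≡o⇒o∸m≡n : ∀ t k {n} → t + k ≡ n → n ∸ t ≡ k
m+n≡o⇒o∸m≡n t k refl = m+n∸m≡n t k

module RepunitCycle (a q : ℕ) .{{_ : NonZero a}} (a<q : a < q) where

  private
    g = suc a
    m = repunit g q

  -- a times the t-th point of the cycle with digits l, in closed form.
  D : ℕ → ℕ
  D t = repunit g (a ∸ t) + g ^ (q ∸ t) * repunit g (t ⊓ a)

  l : ℕ → ℕ
  l t with t <? a
  ... | yes _ = m
  ... | no  _ = 0

  D-early : ∀ {t k s} → t + k ≡ a → t + s ≡ q → D t ≡ repunit g k + g ^ s * repunit g t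
  D-early {t} {k} {s} t+k≡a t+s≡q = trans
    (cong₂ (λ u v → repunit g u + g ^ v * repunit g (t ⊓ a)) (m+n≡o⇒o∸m≡n t k t+k≡a) (m+n≡o⇒o∸m≡n t s t+s≡q))
    (cong (λ u → repunit g k + g ^ s * repunit g u) (m≤n⇒m⊓n≡m (subst (t ≤_) t+k≡a (m≤m+n t k))))

  D-late : ∀ {t s} → a ≤ t → t + s ≡ q → D t ≡ g ^ s * repunit g a
  D-late {t} {s} a≤t t+s≡q = trans
    (cong₂ (λ u v → repunit g u + g ^ v * repunit g (t ⊓ a)) (m≤n⇒m∸n≡0 a≤t) (m+n≡o⇒o∸m≡n t s t+s≡q))
    (cong (λ u → g ^ s * repunit g u) (m≥n⇒m⊓n≡n a≤t))

  D-move : ∀ t → t < q → g * D (suc t) ≡ D t + a * l t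
  D-move t t<q with t <? a
  ... | yes t<a = suc-injective (begin
    1 + g * D (suc t)                                ≡⟨ cong (λ u → 1 + g * u) (D-early {suc t} {k} {s} 1+t+k≡a 1+t+s≡q) ⟩
    1 + g * (repunit g k + g ^ s * repunit g (suc t)) ≡⟨ repunit-shift g k s t ⟩
    (repunit g (suc k) + g ^ suc s * repunit g t) + g ^ (suc s + t)
                                                     ≡⟨ cong₂ _+_ (D-early {t} {suc k} {suc s} t+1+k≡a t+1+s≡q) (cong (λ u → g ^ u) (sym s+1+t≡q)) ⟨
    D t + g ^ q                                      ≡⟨ cong (λ u → D t + u) (^≡1+a*repunit a q) ⟩
    D t + (1 + a * m)                                ≡⟨ +-suc (D t) (a * m) ⟩
    1 + (D t + a * m)                                ∎)
    where
    open ≡-Reasoning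
    k = a ∸ suc t
    s = q ∸ suc t
    1+t+k≡a : suc t + k ≡ a
    1+t+k≡a = m+[n∸m]≡n t<a
    1+t+s≡q : suc t + s ≡ q
    1+t+s≡q = m+[n∸m]≡n t<q
    t+1+k≡a : t + suc k ≡ a
    t+1+k≡a = trans (+-suc t k) 1+t+k≡a
    t+1+s≡q : t + suc s ≡ q
    t+1+s≡q = trans (+-suc t s) 1+t+s≡q
    s+1+t≡q : suc s + t ≡ q
    s+1+t≡q = trans (+-comm (suc s) t) t+1+s≡q
  ... | no t≮a = begin
    g * D (suc t)                    ≡⟨ cong (g *_) (D-late {suc t} {s} (≤-trans (≮⇒≥ t≮a) (n≤1+n t)) (m+[n∸m]≡n t<q)) ⟩
    g * (g ^ s * repunit g a)        ≡⟨ *-assoc g (g ^ s) (repunit g a) ⟨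
    g ^ suc s * repunit g a          ≡⟨ D-late (≮⇒≥ t≮a) (trans (+-suc t s) (m+[n∸m]≡n t<q)) ⟨
    D t                              ≡⟨ +-identityʳ (D t) ⟨
    D t + 0                          ≡⟨ cong (λ u → D t + u) (*-zeroʳ a) ⟨
    D t + a * 0                      ∎
    where
    open ≡-Reasoning
    s = q ∸ suc t

  D-start : D 0 ≡ repunit g a
  D-start = trans (cong (λ u → repunit g a + u) (*-zeroʳ (g ^ q))) (+-identityʳ _)

  D-end : D q ≡ repunit g a
  D-end = trans (D-late {q} {0} (<⇒≤ a<q) (+-identityʳ q)) (*-identityˡ (repunit g a))

  a∣D : ∀ t → t ≤ q → a ∣ D t
  a∣D zero    _   = subst (a ∣_) (sym D-start) (divides (suc c) Rₐ≡a+c*a)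
    where
    c = proj₁ (repunit≡k+t*a a a)
    Rₐ≡a+c*a = proj₂ (repunit≡k+t*a a a)
  a∣D (suc t) t<q = ∣m+n∣m⇒∣n (subst (a ∣_) (+-comm (D (suc t)) (a * D (suc t))) a∣gD) (m∣m*n (D (suc t)))
    where
    a∣gD : a ∣ g * D (suc t)
    a∣gD = subst (a ∣_) (sym (D-move t t<q)) (∣m∣n⇒∣m+n (a∣D t (<⇒≤ t<q)) (m∣m*n (l t)))

  z : ℕ → ℕ
  z t = D t / a

  a*z : ∀ t → t ≤ q → a * z t ≡ D t
  a*z t t≤q = trans (*-comm a (z t)) (m/n*n≡m (a∣D t t≤q))

  z-move : ∀ t → t < q → g * z (suc t) ≡ z t + l t
  z-move t t<q = *-cancelˡ-≡ (g * z (suc t)) (z t + l t) a (begin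
    a * (g * z (suc t))     ≡⟨ *-assoc a g (z (suc t)) ⟨
    a * g * z (suc t)       ≡⟨ cong (_* z (suc t)) (*-comm a g) ⟩
    g * a * z (suc t)       ≡⟨ *-assoc g a (z (suc t)) ⟩
    g * (a * z (suc t))     ≡⟨ cong (g *_) (a*z (suc t) t<q) ⟩
    g * D (suc t)           ≡⟨ D-move t t<q ⟩
    D t + a * l t           ≡⟨ cong (λ u → u + a * l t) (a*z t (<⇒≤ t<q)) ⟨
    a * z t + a * l t       ≡⟨ *-distribˡ-+ a (z t) (l t) ⟨
    a * (z t + l t)         ∎)
    where open ≡-Reasoning

  l-digit : ∀ t → l t ≡ 0 ⊎ l t ≡ m
  l-digit t with t <? a
  ... | yes _ = inj₂ refl
  ... | no  _ = inj₁ refl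

  z-start≢0 : z 0 ≢ 0
  z-start≢0 z₀≡0 = <⇒≢ (repunit-pos (>-nonZero⁻¹ a)) (sym (begin
    repunit g a     ≡⟨ trans (a*z 0 z≤n) D-start ⟨
    a * z 0         ≡⟨ cong (a *_) z₀≡0 ⟩
    a * 0           ≡⟨ *-zeroʳ a ⟩
    0               ∎))
    where open ≡-Reasoning

  repunit-incomplete : 2 ∣ g → Incomplete g m
  repunit-incomplete 2∣g = periodic-orbit→incomplete z-start≢0
    (trajectory-returns 2∣g (repunit-odd 2∣g 1≤q) z l q z-move (λ t _ → l-digit t)
      1≤q (cong (_/ a) (trans D-end (sym D-start))))
    where
    open Dynamics g m
    1≤q : 1 ≤ q
    1≤q = ≤-trans (>-nonZero⁻¹ a) (<⇒≤ a<q)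

∣repunit⇒∣^∸1 : ∀ a q {e} → e ∣ repunit (suc a) q → e ∣ suc a ^ q ∸ 1
∣repunit⇒∣^∸1 a q {e} e∣R = subst (e ∣_) (sym (^∸1≡a*repunit a q)) (∣n⇒∣m*n a e∣R)

repunit-order : ∀ {a q} → 1 ≤ a → 1 ≤ q → Order (suc a) (repunit (suc a) q) q
repunit-order {a} {q} 1≤a 1≤q = 1≤q , ∣repunit⇒∣^∸1 a q ∣-refl , least
  where
  least : ∀ j → 1 ≤ j → repunit (suc a) q ∣ suc a ^ j ∸ 1 → q ≤ j
  least j 1≤j R∣ⱼ with q ≤? j
  ... | yes q≤j = q≤j
  ... | no  q≰j = ⊥-elim (<⇒≱ aRⱼ<R (∣⇒≤ {{>-nonZero 0<aRⱼ}} (subst (repunit (suc a) q ∣_) (^∸1≡a*repunit a j) R∣ⱼ)))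
    where
    aRⱼ<R : a * repunit (suc a) j < repunit (suc a) q
    aRⱼ<R = <-≤-trans (s≤s (m≤n+m _ (repunit (suc a) j))) (repunit-mono-≤ (suc a) (≰⇒> q≰j))
    0<aRⱼ : 0 < a * repunit (suc a) j
    0<aRⱼ = *-mono-≤ 1≤a (repunit-pos 1≤j)

repunit-coprime : ∀ {a q} → Coprime q a → Coprime (repunit (suc a) q) a
repunit-coprime {a} {q} coprime {e} (e∣R , e∣a) with repunit≡k+t*a a q
... | c , R≡q+ca = coprime (e∣q , e∣a)
  where
  e∣q : e ∣ q
  e∣q = ∣m+n∣m⇒∣n (subst (e ∣_) (trans R≡q+ca (+-comm q (c * a))) e∣R) (∣n⇒∣m*n c e∣a)

repunit-divisor-order : ∀ {a q e} → Coprime q a → 1 ≤ q → e ∣ repunit (suc a) q → 1 < e →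
                        ∃[ k ] Order (suc a) e k × k ≢ 1 × k ∣ q
repunit-divisor-order {a} {q} {e} coprime 1≤q e∣R 1<e with order-exists 1≤q (∣repunit⇒∣^∸1 a q e∣R)
... | k , order = k , order , k≢1 , order∣ order (∣repunit⇒∣^∸1 a q e∣R)
  where
  k≢1 : k ≢ 1
  k≢1 refl = <⇒≢ 1<e (sym (repunit-coprime coprime (e∣R , e∣a)))
    where
    e∣a : e ∣ a
    e∣a = subst (e ∣_) (cong (_∸ 1) (*-identityʳ (suc a))) (proj₁ (proj₂ order))

repunit-prime-divisor-order : ∀ {a q e} → Prime q → Coprime q a → e ∣ repunit (suc a) q → 1 < e →
                              Order (suc a) e q
repunit-prime-divisor-order {a} {q} {e} q-prime coprime e∣R 1<e
  with repunit-divisor-order coprime (>-nonZero⁻¹ q {{prime⇒nonZero q-prime}}) e∣R 1<e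
... | k , order , k≢1 , k∣q with prime⇒irreducible q-prime k∣q
...   | inj₁ k≡1 = ⊥-elim (k≢1 k≡1)
...   | inj₂ k≡q = subst (Order (suc a) e) k≡q order

primitive⇒>1 : ∀ {g d} → 3 ≤ g → d ≢ 0 → Primitive g d → 1 < d
primitive⇒>1 {d = zero}        _   d≢0 _                 = ⊥-elim (d≢0 refl)
primitive⇒>1 {d = suc zero}    3≤g _   (_ , incomplete , _) = ⊥-elim (1-complete 3≤g incomplete)
primitive⇒>1 {d = suc (suc _)} _   _   _                 = s≤s (s≤s z≤n)

a*m≡^∸1⇒m≡repunit : ∀ {a} q {m} → 1 ≤ a → a * m ≡ suc a ^ q ∸ 1 → m ≡ repunit (suc a) q
a*m≡^∸1⇒m≡repunit {a} q {m} 1≤a a*m≡ = *-cancelˡ-≡ m (repunit (suc a) q) a {{>-nonZero 1≤a}} (trans a*m≡ (^∸1≡a*repunit a q))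

theorem2p23 : (g q m : ℕ) → 2 ∣ g → 4 ≤ g → g ∸ 1 < q → Coprime q (g ∸ 1) →
    (g ∸ 1) * m ≡ g ^ q ∸ 1 →
    (Incomplete g m × Order g m q
      × (∀ e → e ∣ m → 1 < e → Σ ℕ λ k → Order g e k × k ≢ 1 × k ∣ q))
    × (Prime q →
        (Σ ℕ λ d → Primitive g d × Order g d q)
        × (∀ d → d ∣ m → Primitive g d → Order g d q))
theorem2p23 (suc a) q m 2∣g (s≤s 3≤a) a<q coprime a*m≡g^q∸1
  with refl ← a*m≡^∸1⇒m≡repunit q (≤-trans (s≤s z≤n) 3≤a) a*m≡g^q∸1 =
  (incomplete , repunit-order 1≤a 1≤q , λ e e∣m 1<e → repunit-divisor-order coprime 1≤q e∣m 1<e) ,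
  λ q-prime → primitive-of-order-q q-prime , primitive-order q-prime
  where
  1≤a : 1 ≤ a
  1≤a = ≤-trans (s≤s z≤n) 3≤a
  1≤q : 1 ≤ q
  1≤q = ≤-trans (s≤s z≤n) a<q
  m≢0 : repunit (suc a) q ≢ 0
  m≢0 = ≢-nonZero⁻¹ _ {{>-nonZero (repunit-pos 1≤q)}}
  incomplete : Incomplete (suc a) (repunit (suc a) q)
  incomplete = RepunitCycle.repunit-incomplete a q {{>-nonZero 1≤a}} a<q 2∣g
  decide : ∀ d → d ∣ repunit (suc a) q → Dec (Incomplete (suc a) d)
  decide d d∣m = incomplete? 1≤a 2∣g (λ 2∣d → repunit-odd 2∣g 1≤q (∣-trans 2∣d d∣m))
  primitive-order : Prime q → ∀ d → d ∣ repunit (suc a) q → Primitive (suc a) d → Order (suc a) d q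
  primitive-order q-prime d d∣m primitiveᵈ = repunit-prime-divisor-order q-prime coprime d∣m
    (primitive⇒>1 (m≤n⇒m≤1+n 3≤a) (λ { refl → m≢0 (0∣⇒≡0 d∣m) }) primitiveᵈ)
  primitive-of-order-q : Prime q → ∃[ d ] Primitive (suc a) d × Order (suc a) d q
  primitive-of-order-q q-prime with primitive-divisor decide m≢0 (repunit-odd 2∣g 1≤q) incomplete
  ... | d , d∣m , primitiveᵈ = d , primitiveᵈ , primitive-order q-prime d d∣m primitiveᵈ
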